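{- Let $\Gamma$ be a finite Abelian group with $|\Gamma|\ge 3$. Let $G$ be a graph with at least one pendant vertex such that every non-pendant vertex is in $\Omega_{\mathfrak{s}}(G)$ or in $\Omega_{\mathfrak{n}}(G)$. If there exists a nonzero $g\in\Gamma$ such that $\deg(x)\equiv 1\pmod{o(g)}$ for all $x\in\Omega_{\mathfrak{n}}(G)$, then $G$ is $\Gamma$-vertex magic.
   Context: Graphs are finite, simple and undirected; $o(g)$ is the order of $g$. For an additive Abelian group $\Gamma$ with identity $0$ and a graph $G$, a $\Gamma$-vertex magic labeling is a map $\ell:V(G)\to\Gamma\setminus\{0\}$ for which there is $\mu\in\Gamma$ with $w(v)=\sum_{u\in N(v)}\ell(u)=\mu$ for every vertex $v$; $G$ is $\Gamma$-vertex magic if it has such a labeling. A pendant vertex has degree $1$; a support vertex is one adjacent to a pendant vertex. $\Omega_{\mathfrak{s}}(G)$ is the set of strong support vertices (adjacent to at least two pendant vertices) and $\Omega_{\mathfrak{n}}(G)$ the set of neutral vertices (neither pendant nor support). -}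

module Defs where

open import Level using (Level; _⊔_)
open import Data.Nat using (ℕ; zero; suc; _<_; _≤_)
open import Data.Bool using (Bool; true; false; if_then_else_)
open import Data.Fin using (Fin)
import Data.Fin as Fin
open import Data.Product using (Σ; ∃; _×_; _,_)
open import Data.Sum using (_⊎_)
open import Relation.Nullary using (¬_)
open import Relation.Binary.PropositionalEquality using (_≡_; _≢_)
import Relation.Binary.PropositionalEquality as ≡
open import Function.Bundles using (Inverse)
open import Algebra.Bundles using (AbelianGroup)
open import Data.Integer using (ℤ; +_; _-_)
import Data.Integer.Divisibility as ℤD

record Graph (n : ℕ) : Set where
  field
    adj   : Fin n → Fin n → Bool
    sym   : ∀ u v → adj u v ≡ adj v u
    irrefl : ∀ v → adj v v ≡ false

module _ {n : ℕ} (G : Graph n) where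
  open Graph G

  Adj : Fin n → Fin n → Set
  Adj u v = adj u v ≡ true

  private
    count : ∀ {m} → (Fin m → Bool) → ℕ
    count {zero} f = 0
    count {suc m} f = (if f Fin.zero then 1 else 0) Data.Nat.+ count (λ i → f (Fin.suc i))

  deg : Fin n → ℕ
  deg v = count (adj v)

  Pendant : Fin n → Set
  Pendant v = deg v ≡ 1

  Support : Fin n → Set
  Support v = ∃ λ u → Adj v u × Pendant u

  StrongSupport : Fin n → Set
  StrongSupport v = Σ (Fin n) λ u → Σ (Fin n) λ w →
    u ≢ w × Adj v u × Pendant u × Adj v w × Pendant w

  Neutral : Fin n → Set
  Neutral v = ¬ Pendant v × ¬ Support v

module _ {c ℓ : Level} (Γ : AbelianGroup c ℓ) where
  open AbelianGroup Γ renaming (Carrier to A)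

  HasCard : ℕ → Set (c ⊔ ℓ)
  HasCard m = Inverse setoid (≡.setoid (Fin m))

  FiniteAtLeast3 : Set (c ⊔ ℓ)
  FiniteAtLeast3 = Σ ℕ λ m → 3 ≤ m × HasCard m

  _·_ : ℕ → A → A
  zero · g = ε
  suc k · g = g ∙ (k · g)

  IsOrder : A → ℕ → Set ℓ
  IsOrder g k = 0 < k × (k · g) ≈ ε × (∀ j → 0 < j → j < k → ¬ (j · g) ≈ ε)

  sumFin : ∀ {m} → (Fin m → A) → A
  sumFin {zero} f = ε
  sumFin {suc m} f = f Fin.zero ∙ sumFin (λ i → f (Fin.suc i))

  weight : ∀ {n} → Graph n → (Fin n → A) → Fin n → A
  weight G lab v = sumFin (λ u → if Graph.adj G v u then lab u else ε)

  IsVertexMagicLabeling : ∀ {n} → Graph n → (Fin n → A) → Set (c ⊔ ℓ)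
  IsVertexMagicLabeling G lab =
    (∀ v → ¬ lab v ≈ ε) × Σ A λ μ → ∀ v → weight G lab v ≈ μ

  IsVertexMagic : ∀ {n} → Graph n → Set (c ⊔ ℓ)
  IsVertexMagic {n} G = Σ (Fin n → A) λ lab → IsVertexMagicLabeling G lab

_≡_[mod_] : ℕ → ℕ → ℕ → Set
a ≡ b [mod k ] = (+ k) ℤD.∣ ((+ a) - (+ b))

{-# OPTIONS --safe #-}
-- Label every vertex g, except that at each strong support s two of its pendant neighbours get
-- labels a, b ≠ 0 with a + b = (3 - deg s) g; such an a exists because Γ has an element other
-- than 0 and (3 - deg s) g. Then every pendant vertex sees the label g of its neighbour, a
-- neutral vertex sees deg · g = g since deg ≡ 1 (mod o(g)), and a strong support sees
-- (deg s - 2) g + a + b = g.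
module Submission where

open import Defs
open import Level using (Level)
open import Data.Nat using (ℕ; zero; suc; _+_; _*_; s≤s)
import Data.Nat as ℕ
open import Data.Nat.Properties using (suc-injective)
open import Data.Nat.Divisibility using (divides; ∣1⇒≡1)
open import Data.Bool using (Bool; true; false; if_then_else_)
import Data.Bool as Bool
open import Data.Fin using (Fin; zero; suc)
import Data.Fin as Fin
open import Data.Fin.Properties using (any?)
open import Data.Vec.Functional using (updateAt)
open import Data.Vec.Functional.Properties using (updateAt-updates; updateAt-minimal)
open import Data.Product using (Σ; ∃; _×_; _,_; proj₁; proj₂)
open import Data.Sum using (_⊎_; inj₁; inj₂)
open import Function using (_∘_)
open import Relation.Nullary using (¬_; yes; no; does; contradiction)
open import Relation.Nullary.Decidable using (_×-dec_; ¬?; dec-true; dec-false)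
open import Relation.Unary using (Pred; Decidable)
open import Relation.Binary.Bundles using (Setoid)
open import Relation.Binary.PropositionalEquality as ≡ using (_≡_; _≢_; refl)
open import Algebra.Bundles using (AbelianGroup)
open import Function.Bundles using (Inverse)

∃≢₂ : ∀ {m} (i j : Fin (3 + m)) → ∃ λ k → k ≢ i × k ≢ j
∃≢₂ zero          zero          = suc zero , (λ ()) , (λ ())
∃≢₂ zero          (suc zero)    = suc (suc zero) , (λ ()) , (λ ())
∃≢₂ zero          (suc (suc _)) = suc zero , (λ ()) , (λ ())
∃≢₂ (suc zero)    zero          = suc (suc zero) , (λ ()) , (λ ())
∃≢₂ (suc (suc _)) zero          = suc zero , (λ ()) , (λ ())
∃≢₂ (suc _)       (suc _)       = zero , (λ ()) , (λ ())

module _ {c ℓ} (S : Setoid c ℓ) {m : ℕ} (card : Inverse S (≡.setoid (Fin (3 + m)))) where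
  open Setoid S
  open Inverse card

  ∃≉₂ : ∀ x y → ∃ λ z → ¬ z ≈ x × ¬ z ≈ y
  ∃≉₂ x y with ∃≢₂ (to x) (to y)
  ... | k , k≢x , k≢y = from k , k≢x ∘ to-from , k≢y ∘ to-from
    where
    to-from : ∀ {w} → from k ≈ w → k ≡ to w
    to-from e = ≡.trans (≡.sym (strictlyInverseˡ k)) (to-cong e)

-- Defs keeps its counting function private; the degree of the centre of a star exposes it.
star : ∀ {m} → (Fin m → Bool) → Graph (suc m)
star {m} f = record { adj = edge ; sym = edge-sym ; irrefl = edge-irrefl }
  where
  edge : Fin (suc m) → Fin (suc m) → Bool
  edge zero    (suc j) = f j
  edge (suc i) zero    = f i
  edge _       _       = false

  edge-sym : ∀ u v → edge u v ≡ edge v u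
  edge-sym zero    zero    = refl
  edge-sym zero    (suc j) = refl
  edge-sym (suc i) zero    = refl
  edge-sym (suc i) (suc j) = refl

  edge-irrefl : ∀ v → edge v v ≡ false
  edge-irrefl zero    = refl
  edge-irrefl (suc i) = refl

countTrue : ∀ {m} → (Fin m → Bool) → ℕ
countTrue f = deg (star f) zero

countTrue≡0⇒≢true : ∀ {m} (f : Fin m → Bool) i → countTrue f ≡ 0 → f i ≢ true
countTrue≡0⇒≢true {suc _} f i c with f zero in f₀
countTrue≡0⇒≢true f zero    c | false = λ f₀≡true → contradiction (≡.trans (≡.sym f₀≡true) f₀) λ ()
countTrue≡0⇒≢true f (suc i) c | false = countTrue≡0⇒≢true (f ∘ suc) i c

countTrue≡1⇒unique : ∀ {m} (f : Fin m → Bool) {i j} → countTrue f ≡ 1 → f i ≡ true → f j ≡ true → i ≡ j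
countTrue≡1⇒unique {suc _} f {i} {j} c fi fj with f zero in f₀
... | true = ≡.trans (at-zero i fi) (≡.sym (at-zero j fj))
  where
  at-zero : ∀ k → f k ≡ true → k ≡ zero
  at-zero zero    _  = refl
  at-zero (suc k) fk = contradiction fk (countTrue≡0⇒≢true (f ∘ suc) k (suc-injective c))
countTrue≡1⇒unique f {zero}  {_}     c fi fj | false = contradiction (≡.trans (≡.sym fi) f₀) λ ()
countTrue≡1⇒unique f {suc _} {zero}  c fi fj | false = contradiction (≡.trans (≡.sym fj) f₀) λ ()
countTrue≡1⇒unique f {suc i} {suc j} c fi fj | false = ≡.cong suc (countTrue≡1⇒unique (f ∘ suc) c fi fj)

countTrue≡suc⇒∃ : ∀ {m} (f : Fin m → Bool) {k} → countTrue f ≡ suc k → ∃ λ i → f i ≡ true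
countTrue≡suc⇒∃ {suc _} f c with f zero in f₀
... | true  = zero , f₀
... | false = let i , fi = countTrue≡suc⇒∃ (f ∘ suc) c in suc i , fi

module _ {m p} {P : Pred (Fin m) p} (P? : Decidable P) where

  pick : Fin m → Fin m
  pick default with any? P?
  ... | yes (i , _) = i
  ... | no _        = default

  pick-satisfies : ∀ default → ∃ P → P (pick default)
  pick-satisfies default ∃P with any? P?
  ... | yes (_ , Pi) = Pi
  ... | no ¬∃P       = contradiction ∃P ¬∃P

updateAt-preserves : ∀ {a p} {A : Set a} (Q : Pred A p) {m} {xs : Fin m → A} {j f} →
                     (∀ i → Q (xs i)) → Q (f (xs j)) → ∀ i → Q (updateAt xs j f i)
updateAt-preserves Q {j = zero}  Qxs Qf zero    = Qf
updateAt-preserves Q {j = zero}  Qxs Qf (suc i) = Qxs (suc i)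
updateAt-preserves Q {j = suc j} Qxs Qf zero    = Qxs zero
updateAt-preserves Q {j = suc j} Qxs Qf (suc i) = updateAt-preserves Q (Qxs ∘ suc) Qf i

module _ {n : ℕ} (G : Graph n) where
  open Graph G

  pendant? : Decidable (Pendant G)
  pendant? v = deg G v ℕ.≟ 1

  adjacent? : ∀ u → Decidable (Adj G u)
  adjacent? u v = adj u v Bool.≟ true

  Adj-sym : ∀ {u v} → Adj G u v → Adj G v u
  Adj-sym {u} {v} = ≡.trans (sym v u)

  support : Fin n → Fin n
  support v = pick (adjacent? v) v

  support-adjacent : ∀ {v} → Pendant G v → Adj G v (support v)
  support-adjacent {v} pv = pick-satisfies (adjacent? v) v (countTrue≡suc⇒∃ (adj v) pv)

  pendant⇒support-unique : ∀ {v u} → Pendant G v → Adj G v u → support v ≡ u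
  pendant⇒support-unique {v} pv = countTrue≡1⇒unique (adj v) pv (support-adjacent pv)

module _ {c ℓ} (Γ : AbelianGroup c ℓ) where
  open AbelianGroup Γ renaming (Carrier to A; refl to ≈-refl)
  open import Algebra.Properties.CommutativeSemigroup commutativeSemigroup using (x∙yz≈y∙xz; xy∙z≈x∙zy)
  open import Relation.Binary.Reasoning.Setoid setoid

  infixr 8 _⋆_
  _⋆_ : ℕ → A → A
  _⋆_ = _·_ Γ

  ⋆-homo-+ : ∀ m n x → (m + n) ⋆ x ≈ m ⋆ x ∙ n ⋆ x
  ⋆-homo-+ zero    n x = sym (identityˡ _)
  ⋆-homo-+ (suc m) n x = trans (∙-congˡ (⋆-homo-+ m n x)) (sym (assoc _ _ _))

  ⋆≈ε⇒*⋆≈ε : ∀ {k x} → k ⋆ x ≈ ε → ∀ q → (q * k) ⋆ x ≈ ε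
  ⋆≈ε⇒*⋆≈ε         kx≈ε zero    = ≈-refl
  ⋆≈ε⇒*⋆≈ε {k} {x} kx≈ε (suc q) = begin
    (k + q * k) ⋆ x   ≈⟨ ⋆-homo-+ k (q * k) x ⟩
    k ⋆ x ∙ (q * k) ⋆ x ≈⟨ ∙-cong kx≈ε (⋆≈ε⇒*⋆≈ε kx≈ε q) ⟩
    ε ∙ ε             ≈⟨ identityʳ ε ⟩
    ε                 ∎

  ⋆≈ε⇒≡1[mod]⇒⋆≈id : ∀ {k x} → k ⋆ x ≈ ε → ∀ d → d ≡ 1 [mod k ] → d ⋆ x ≈ x
  ⋆≈ε⇒≡1[mod]⇒⋆≈id {x = x} kx≈ε zero k∣1 with ∣1⇒≡1 k∣1
  ... | refl = sym (trans (sym (identityʳ x)) kx≈ε)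
  ⋆≈ε⇒≡1[mod]⇒⋆≈id {x = x} kx≈ε (suc d) (divides q refl) =
    trans (∙-congˡ (⋆≈ε⇒*⋆≈ε kx≈ε q)) (identityʳ x)

  maskedSum : ∀ {m} → (Fin m → Bool) → (Fin m → A) → A
  maskedSum P f = sumFin Γ (λ i → if P i then f i else ε)

  maskedSum-cong : ∀ {m} (P : Fin m → Bool) {f h : Fin m → A} →
                   (∀ i → P i ≡ true → f i ≈ h i) → maskedSum P f ≈ maskedSum P h
  maskedSum-cong {zero}  P f≈h = ≈-refl
  maskedSum-cong {suc m} P f≈h = ∙-cong (if-cong (P zero) (f≈h zero)) (maskedSum-cong (P ∘ suc) (f≈h ∘ suc))
    where
    if-cong : ∀ b {x y} → (b ≡ true → x ≈ y) → (if b then x else ε) ≈ (if b then y else ε)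
    if-cong true  x≈y = x≈y refl
    if-cong false _   = ≈-refl

  maskedSum-const : ∀ {m} (P : Fin m → Bool) x → maskedSum P (λ _ → x) ≈ countTrue P ⋆ x
  maskedSum-const {zero}  P x = ≈-refl
  maskedSum-const {suc m} P x with P zero
  ... | true  = ∙-congˡ (maskedSum-const (P ∘ suc) x)
  ... | false = trans (identityˡ _) (maskedSum-const (P ∘ suc) x)

  maskedSum-updateAt : ∀ {m} (P : Fin m → Bool) (xs : Fin m → A) i {f : A → A} → P i ≡ true →
                       maskedSum P (updateAt xs i f) ∙ xs i ≈ f (xs i) ∙ maskedSum P xs
  maskedSum-updateAt P xs zero    Pi rewrite Pi = xy∙z≈x∙zy _ _ _
  maskedSum-updateAt P xs (suc i) Pi =
    trans (assoc _ _ _) (trans (∙-congˡ (maskedSum-updateAt (P ∘ suc) (xs ∘ suc) i Pi)) (x∙yz≈y∙xz _ _ _))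

  module Labelling (avoid : ∀ h → ∃ λ a → ¬ a ≈ ε × ¬ a ≈ h) {n : ℕ} (G : Graph n) (g : A) (g≉ε : ¬ g ≈ ε) where

    open Graph G using (adj)
    open import Algebra.Properties.AbelianGroup Γ using (∙-cancelʳ; \\-leftDividesˡ; //-rightDividesˡ)

    PendantNeighbour : Fin n → Pred (Fin n) _
    PendantNeighbour s u = Adj G s u × Pendant G u

    leaf₁ leaf₂ : Fin n → Fin n
    leaf₁ s = pick (λ u → adjacent? G s u ×-dec pendant? G u) s
    leaf₂ s = pick (λ u → (adjacent? G s u ×-dec pendant? G u) ×-dec ¬? (u Fin.≟ leaf₁ s)) s

    strongSupport⇒leaves : ∀ {s} → StrongSupport G s →
      PendantNeighbour s (leaf₁ s) × PendantNeighbour s (leaf₂ s) × leaf₂ s ≢ leaf₁ s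
    strongSupport⇒leaves {s} (u , w , u≢w , su , pu , sw , pw) = first , pick-satisfies _ s second
      where
      first : PendantNeighbour s (leaf₁ s)
      first = pick-satisfies _ s (u , su , pu)
      second : ∃ λ x → PendantNeighbour s x × x ≢ leaf₁ s
      second with u Fin.≟ leaf₁ s
      ... | no  u≢leaf = u , (su , pu) , u≢leaf
      ... | yes u≡leaf = w , (sw , pw) , λ w≡leaf → u≢w (≡.trans u≡leaf (≡.sym w≡leaf))

    target : Fin n → A
    target s = (g ∙ (g ∙ g)) - (deg G s ⋆ g)

    a b : Fin n → A
    a s = proj₁ (avoid (target s))
    b s = a s ⁻¹ ∙ target s

    a≉ε : ∀ s → ¬ a s ≈ ε
    a≉ε s = proj₁ (proj₂ (avoid (target s)))

    b≉ε : ∀ s → ¬ b s ≈ ε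
    b≉ε s b≈ε = proj₂ (proj₂ (avoid (target s))) (begin
      a s             ≈⟨ identityʳ (a s) ⟨
      a s ∙ ε         ≈⟨ ∙-congˡ b≈ε ⟨
      a s ∙ b s       ≈⟨ \\-leftDividesˡ (a s) (target s) ⟩
      target s        ∎)

    bAtLeaf₂ supportLabel : Fin n → Fin n → A
    bAtLeaf₂ s     = updateAt (λ _ → g) (leaf₂ s) (λ _ → b s)
    supportLabel s = updateAt (bAtLeaf₂ s) (leaf₁ s) (λ _ → a s)

    supportLabel≉ε : ∀ s u → ¬ supportLabel s u ≈ ε
    supportLabel≉ε s =
      updateAt-preserves (λ x → ¬ x ≈ ε) (updateAt-preserves (λ x → ¬ x ≈ ε) (λ _ → g≉ε) (b≉ε s)) (a≉ε s)

    Leaf : Pred (Fin n) _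
    Leaf v = Pendant G v × ¬ Pendant G (support G v)

    leaf? : Decidable Leaf
    leaf? v = pendant? G v ×-dec ¬? (pendant? G (support G v))

    label : Fin n → A
    label v = if does (leaf? v) then supportLabel (support G v) v else g

    label-nonLeaf : ∀ {v} → ¬ Leaf v → label v ≡ g
    label-nonLeaf {v} ¬leaf rewrite dec-false (leaf? v) ¬leaf = refl

    label-leaf : ∀ {v} → Leaf v → label v ≡ supportLabel (support G v) v
    label-leaf {v} leaf rewrite dec-true (leaf? v) leaf = refl

    label≉ε : ∀ v → ¬ label v ≈ ε
    label≉ε v with does (leaf? v)
    ... | true  = supportLabel≉ε (support G v) v
    ... | false = g≉ε

    label-support : ∀ {v} → Pendant G v → label (support G v) ≡ g
    label-support {v} pv with pendant? G (support G v)
    ... | no  ¬ps = label-nonLeaf (¬ps ∘ proj₁)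
    ... | yes ps  = label-nonLeaf λ (_ , ¬pss) → ¬pss (≡.subst (Pendant G) (≡.sym supp²v≡v) pv)
      where
      supp²v≡v : support G (support G v) ≡ v
      supp²v≡v = pendant⇒support-unique G ps (Adj-sym G (support-adjacent G pv))

    weight-uniform : ∀ v → (∀ u → Adj G v u → label u ≡ g) → weight Γ G label v ≈ deg G v ⋆ g
    weight-uniform v label≡g =
      trans (maskedSum-cong (adj v) (λ u → reflexive ∘ label≡g u)) (maskedSum-const (adj v) g)

    weight-pendant : ∀ {v} → Pendant G v → weight Γ G label v ≈ g
    weight-pendant {v} pv = begin
      weight Γ G label v ≈⟨ weight-uniform v label≡g ⟩
      deg G v ⋆ g        ≡⟨ ≡.cong (_⋆ g) pv ⟩
      g ∙ ε              ≈⟨ identityʳ g ⟩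
      g                  ∎
      where
      label≡g : ∀ u → Adj G v u → label u ≡ g
      label≡g u vu = ≡.subst (λ w → label w ≡ g) (pendant⇒support-unique G pv vu) (label-support pv)

    weight-neutral : ∀ {v k} → k ⋆ g ≈ ε → deg G v ≡ 1 [mod k ] → Neutral G v → weight Γ G label v ≈ g
    weight-neutral {v} kg≈ε deg≡1 (_ , ¬support) =
      trans (weight-uniform v λ u vu → label-nonLeaf λ (pu , _) → ¬support (u , vu , pu))
            (⋆≈ε⇒≡1[mod]⇒⋆≈id kg≈ε (deg G v) deg≡1)

    module _ {s} (¬ps : ¬ Pendant G s) (ss : StrongSupport G s) where
      private
        pn₁ : PendantNeighbour s (leaf₁ s)
        pn₁ = proj₁ (strongSupport⇒leaves ss)

        pn₂ : PendantNeighbour s (leaf₂ s)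
        pn₂ = proj₁ (proj₂ (strongSupport⇒leaves ss))

        leaf₂≢leaf₁ : leaf₂ s ≢ leaf₁ s
        leaf₂≢leaf₁ = proj₂ (proj₂ (strongSupport⇒leaves ss))

      label-around-strongSupport : ∀ u → Adj G s u → label u ≡ supportLabel s u
      label-around-strongSupport u su with pendant? G u
      ... | yes pu = ≡.trans (label-leaf (pu , ¬ps ∘ ≡.subst (Pendant G) supp-u≡s))
                             (≡.cong (λ t → supportLabel t u) supp-u≡s)
        where
        supp-u≡s : support G u ≡ s
        supp-u≡s = pendant⇒support-unique G pu (Adj-sym G su)
      ... | no ¬pu = ≡.trans (label-nonLeaf (¬pu ∘ proj₁))
                             (≡.sym (≡.trans (updateAt-minimal u (leaf₁ s) (bAtLeaf₂ s) (≢leaf pn₁))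
                                             (updateAt-minimal u (leaf₂ s) (λ _ → g) (≢leaf pn₂))))
        where
        ≢leaf : ∀ {x} → PendantNeighbour s x → u ≢ x
        ≢leaf (_ , px) u≡x = ¬pu (≡.subst (Pendant G) (≡.sym u≡x) px)

      supportLabel-sum : maskedSum (adj s) (supportLabel s) ∙ (g ∙ g) ≈ g ∙ (g ∙ g)
      supportLabel-sum = begin
        S_ab ∙ (g ∙ g)                  ≈⟨ assoc _ _ _ ⟨
        S_ab ∙ g ∙ g                    ≡⟨ ≡.cong (λ x → S_ab ∙ x ∙ g) bAtLeaf₂-leaf₁ ⟨
        S_ab ∙ bAtLeaf₂ s (leaf₁ s) ∙ g ≈⟨ ∙-congʳ (maskedSum-updateAt (adj s) (bAtLeaf₂ s) (leaf₁ s) (proj₁ pn₁)) ⟩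
        a s ∙ S_b ∙ g                   ≈⟨ assoc _ _ _ ⟩
        a s ∙ (S_b ∙ g)                 ≈⟨ ∙-congˡ (maskedSum-updateAt (adj s) (λ _ → g) (leaf₂ s) (proj₁ pn₂)) ⟩
        a s ∙ (b s ∙ S_g)               ≈⟨ ∙-congˡ (∙-congˡ (maskedSum-const (adj s) g)) ⟩
        a s ∙ (b s ∙ deg G s ⋆ g)       ≈⟨ assoc _ _ _ ⟨
        a s ∙ b s ∙ deg G s ⋆ g         ≈⟨ ∙-congʳ (\\-leftDividesˡ (a s) (target s)) ⟩
        target s ∙ deg G s ⋆ g          ≈⟨ //-rightDividesˡ (deg G s ⋆ g) (g ∙ (g ∙ g)) ⟩
        g ∙ (g ∙ g)                     ∎
        where
        S_ab S_b S_g : A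
        S_ab = maskedSum (adj s) (supportLabel s)
        S_b  = maskedSum (adj s) (bAtLeaf₂ s)
        S_g  = maskedSum (adj s) (λ _ → g)

        bAtLeaf₂-leaf₁ : bAtLeaf₂ s (leaf₁ s) ≡ g
        bAtLeaf₂-leaf₁ = updateAt-minimal (leaf₁ s) (leaf₂ s) (λ _ → g) (leaf₂≢leaf₁ ∘ ≡.sym)

      weight-strongSupport : weight Γ G label s ≈ g
      weight-strongSupport = ∙-cancelʳ (g ∙ g) _ _ (begin
        weight Γ G label s ∙ (g ∙ g)
          ≈⟨ ∙-congʳ (maskedSum-cong (adj s) λ u su → reflexive (label-around-strongSupport u su)) ⟩
        maskedSum (adj s) (supportLabel s) ∙ (g ∙ g)
          ≈⟨ supportLabel-sum ⟩
        g ∙ (g ∙ g)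
          ∎)

    label-isVertexMagic : ∀ {k} → k ⋆ g ≈ ε →
      (∀ v → ¬ Pendant G v → StrongSupport G v ⊎ Neutral G v) →
      (∀ x → Neutral G x → deg G x ≡ 1 [mod k ]) →
      IsVertexMagicLabeling Γ G label
    label-isVertexMagic kg≈ε classify deg≡1 = label≉ε , g , weight≈g
      where
      weight≈g : ∀ v → weight Γ G label v ≈ g
      weight≈g v with pendant? G v
      ... | yes pv = weight-pendant pv
      ... | no ¬pv with classify v ¬pv
      ...   | inj₁ ss      = weight-strongSupport ¬pv ss
      ...   | inj₂ neutral = weight-neutral kg≈ε (deg≡1 v neutral) neutral

theorem2p8 : {c ℓ : Level} (Γ : AbelianGroup c ℓ) → FiniteAtLeast3 Γ →
    {n : ℕ} (G : Graph n) →
    (∃ λ v → Pendant G v) →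
    (∀ v → ¬ Pendant G v → StrongSupport G v ⊎ Neutral G v) →
    (Σ (AbelianGroup.Carrier Γ) λ g → ¬ AbelianGroup._≈_ Γ g (AbelianGroup.ε Γ) ×
      Σ ℕ λ k → IsOrder Γ g k × (∀ x → Neutral G x → deg G x ≡ 1 [mod k ])) →
    IsVertexMagic Γ G
theorem2p8 Γ (suc (suc (suc _)) , s≤s (s≤s (s≤s _)) , card) G _ classify (g , g≉ε , k , (_ , kg≈ε , _) , deg≡1) =
  label , label-isVertexMagic kg≈ε classify deg≡1
  where
  open Labelling Γ (∃≉₂ (AbelianGroup.setoid Γ) card (AbelianGroup.ε Γ)) G g g≉ε
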